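{- If $(X,Y)$ is a decomposition of an odd-hole-free trigraph $T$, then the corresponding blocks $T_X$ and $T_Y$ are odd-hole-free.
   Context: A trigraph $T$ consists of a finite vertex set $V(T)$ and a map $\theta:\binom{V(T)}{2}\to\{ -1,0,1\}$. Distinct $u,v$ are strongly adjacent if $\theta(uv)=1$, strongly antiadjacent if $\theta(uv)=-1$, semiadjacent (a switchable pair) if $\theta(uv)=0$; adjacent if $\theta(uv)\in\{0,1\}$, antiadjacent if $\theta(uv)\in\{ -1,0\}$. $T[X]$ is the restriction to $X$. A hole is an induced subtrigraph $T[\{h_1,\dots,h_k\}]$, $k\ge4$, with $h_i$ adjacent to $h_j$ if $|i-j|\in\{1,k-1\}$ and antiadjacent if $1<|i-j|<k-1$; it is odd if $k$ is odd; $T$ is odd-hole-free if it has no odd hole. A vertex $b\notin A$ is strongly complete (strongly anticomplete) to $A$ if strongly adjacent (strongly antiadjacent) to all of $A$; a set is so if all its vertices are. A homogeneous set is a set $X$ with $1<|X|<|V(T)|$ such that every vertex outside $X$ is strongly complete or strongly anticomplete to $X$. A homogeneous pair is a pair $(A,B)$ of disjoint nonempty sets with a split $(A,B,C,D,E,F)$, where $C,D,E,F$ are disjoint (possibly empty) with union $V(T)\setminus(A\cup B)$, such that $A$ is strongly complete to $C\cup E$ and strongly anticomplete to $D\cup F$, $B$ is strongly complete to $D\cup E$ and strongly anticomplete to $C\cup F$, $A$ is neither strongly complete nor strongly anticomplete to $B$, $|A\cup B|\ge3$ and $|C\cup D\cup E\cup F|\ge3$; it is small if $|A\cup B|\le6$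 and proper if $C\ne\emptyset\ne D$. A decomposition is a partition $(X,Y)$ of $V(T)$ where $X$ is a homogeneous set or $X=A\cup B$ with $(A,B)$ a small or proper homogeneous pair. Block $T_X$: if $X$ is a homogeneous set or a small homogeneous pair, $T_X=T[X]$; otherwise $T_X$ is $T[X]$ plus new vertices $c,d$, $c$ strongly complete to $A$ and strongly anticomplete to $B$, $d$ strongly complete to $B$ and strongly anticomplete to $A$, $cd$ a switchable pair. Block $T_Y$: if $X$ is a homogeneous set, $T_Y=T[Y\cup\{x\}]$ for some $x\in X$; otherwise $T_Y$ is $T[Y]$ plus new vertices $a,b$, $a$ strongly complete to $C\cup E$ and strongly anticomplete to $D\cup F$, $b$ strongly complete to $D\cup E$ and strongly anticomplete to $C\cup F$, $ab$ a switchable pair. -}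

module Defs where

open import Data.Nat using (ℕ; zero; suc; _+_; _*_; _∸_; _≤_; _<_; ∣_-_∣)
open import Data.Fin using (Fin; toℕ) renaming (zero to fz; suc to fs)
open import Data.Bool using (Bool; true; false; if_then_else_; not)
open import Data.Product using (Σ; _×_; _,_; proj₁; ∃)
open import Data.Sum using (_⊎_; inj₁; inj₂)
open import Relation.Binary.PropositionalEquality using (_≡_; _≢_; refl)
open import Relation.Nullary using (¬_)
open import Function using (_∘_)

-- Trigraphs.  θ takes values -1 (neg), 0 (zer), 1 (pos).  θ is given on
-- ordered pairs and required to be symmetric; its value on the diagonal
-- is irrelevant (never used in any definition below).

data Val : Set where
  neg zer pos : Val

record Trigraph (V : Set) : Set where
  field
    θ   : V → V → Val
    sym : ∀ u v → θ u v ≡ θ v u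
open Trigraph public

Adjacent : Val → Set
Adjacent v = v ≡ zer ⊎ v ≡ pos

Antiadjacent : Val → Set
Antiadjacent v = v ≡ neg ⊎ v ≡ zer

CycAdj : (k : ℕ) → Fin k → Fin k → Set
CycAdj k i j = ∣ toℕ i - toℕ j ∣ ≡ 1 ⊎ ∣ toℕ i - toℕ j ∣ ≡ k ∸ 1

record Hole {V : Set} (T : Trigraph V) (k : ℕ) : Set where
  field
    h        : Fin k → V
    length≥4 : 4 ≤ k
    distinct : ∀ i j → h i ≡ h j → i ≡ j
    adj      : ∀ i j → i ≢ j → CycAdj k i j → Adjacent (θ T (h i) (h j))
    antiadj  : ∀ i j → i ≢ j → ¬ CycAdj k i j → Antiadjacent (θ T (h i) (h j))

OddN : ℕ → Set
OddN k = Σ ℕ λ m → k ≡ suc (2 * m)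

OddHoleFree : {V : Set} → Trigraph V → Set
OddHoleFree T = ∀ k → OddN k → ¬ Hole T k

restrict : {V : Set} → Trigraph V → (P : V → Set) → Trigraph (Σ V P)
restrict T P = record
  { θ   = λ u v → θ T (proj₁ u) (proj₁ v)
  ; sym = λ u v → Trigraph.sym T (proj₁ u) (proj₁ v) }

count : {n : ℕ} → (Fin n → Bool) → ℕ
count {zero}  X = 0
count {suc n} X = (if X fz then 1 else 0) + count (X ∘ fs)

StronglyCompleteTo : {n : ℕ} → Trigraph (Fin n) → Fin n → (Fin n → Bool) → Set
StronglyCompleteTo T v X = ∀ x → X x ≡ true → θ T v x ≡ pos

StronglyAnticompleteTo : {n : ℕ} → Trigraph (Fin n) → Fin n → (Fin n → Bool) → Set
StronglyAnticompleteTo T v X = ∀ x → X x ≡ true → θ T v x ≡ neg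

record HomogeneousSet {n : ℕ} (T : Trigraph (Fin n)) (X : Fin n → Bool) : Set where
  field
    size>1 : 1 < count X
    size<n : count X < n
    homog  : ∀ v → X v ≡ false →
             StronglyCompleteTo T v X ⊎ StronglyAnticompleteTo T v X

-- Homogeneous pairs.  A pair (A,B) together with its split
-- (A,B,C,D,E,F) is encoded as a labelling of V(T) by the six parts
-- (this is exactly a partition of V(T) into A,B,C,D,E,F).

data Part : Set where
  pA pB pC pD pE pF : Part

isA isB isC isD isE isF isAB : Part → Bool
isA pA = true
isA _  = false
isB pB = true
isB _  = false
isC pC = true
isC _  = false
isD pD = true
isD _  = false
isE pE = true
isE _  = false
isF pF = true
isF _  = false
isAB pA = true
isAB pB = true
isAB _  = false

_∪_ : {n : ℕ} → (Fin n → Bool) → (Fin n → Bool) → (Fin n → Bool)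
(X ∪ Y) v = if X v then true else Y v

module _ {n : ℕ} (T : Trigraph (Fin n)) (lab : Fin n → Part) where

  SetA SetB SetC SetD SetE SetF SetAB : Fin n → Bool
  SetA  = isA ∘ lab
  SetB  = isB ∘ lab
  SetC  = isC ∘ lab
  SetD  = isD ∘ lab
  SetE  = isE ∘ lab
  SetF  = isF ∘ lab
  SetAB = isAB ∘ lab

  SC SAC : (Fin n → Bool) → (Fin n → Bool) → Set
  SC  X Y = ∀ x y → X x ≡ true → Y y ≡ true → θ T x y ≡ pos
  SAC X Y = ∀ x y → X x ≡ true → Y y ≡ true → θ T x y ≡ neg

  record HomogeneousPair : Set where
    field
      A-nonempty : ∃ λ v → lab v ≡ pA
      B-nonempty : ∃ λ v → lab v ≡ pB
      A-CE   : SC  SetA (SetC ∪ SetE)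
      A-DF   : SAC SetA (SetD ∪ SetF)
      B-DE   : SC  SetB (SetD ∪ SetE)
      B-CF   : SAC SetB (SetC ∪ SetF)
      A-B-not-SC  : ¬ SC  SetA SetB
      A-B-not-SAC : ¬ SAC SetA SetB
      AB≥3   : 3 ≤ count SetAB
      rest≥3 : 3 ≤ count (not ∘ SetAB)

  Small : Set
  Small = count SetAB ≤ 6

  Proper : Set
  Proper = (∃ λ v → lab v ≡ pC) × (∃ λ v → lab v ≡ pD)

data Two : Set where
  new₁ new₂ : Two

toVal : Bool → Val
toVal true  = pos
toVal false = neg

extTheta : {W : Set} → (W → W → Val) → (W → Two → Val) → (W ⊎ Two) → (W ⊎ Two) → Val
extTheta θ₀ f (inj₁ u) (inj₁ v) = θ₀ u v
extTheta θ₀ f (inj₁ u) (inj₂ t) = f u t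
extTheta θ₀ f (inj₂ t) (inj₁ u) = f u t
extTheta θ₀ f (inj₂ new₁) (inj₂ new₂) = zer
extTheta θ₀ f (inj₂ new₂) (inj₂ new₁) = zer
extTheta θ₀ f (inj₂ new₁) (inj₂ new₁) = neg
extTheta θ₀ f (inj₂ new₂) (inj₂ new₂) = neg

extend : {W : Set} → Trigraph W → (W → Two → Val) → Trigraph (W ⊎ Two)
extend {W} T f = record { θ = extTheta (θ T) f ; sym = s }
  where
  s : ∀ u v → extTheta (θ T) f u v ≡ extTheta (θ T) f v u
  s (inj₁ u) (inj₁ v) = Trigraph.sym T u v
  s (inj₁ u) (inj₂ t) = refl
  s (inj₂ t) (inj₁ u) = refl
  s (inj₂ new₁) (inj₂ new₁) = refl
  s (inj₂ new₁) (inj₂ new₂) = refl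
  s (inj₂ new₂) (inj₂ new₁) = refl
  s (inj₂ new₂) (inj₂ new₂) = refl

module _ {n : ℕ} (T : Trigraph (Fin n)) (lab : Fin n → Part) where

  -- T_X for a non-small (proper) homogeneous pair:
  -- T[A ∪ B] plus c (= new₁) strongly complete to A, strongly anticomplete
  -- to B, and d (= new₂) strongly complete to B, strongly anticomplete to A;
  -- cd switchable.
  blockX-ext : Trigraph (Σ (Fin n) (λ v → SetAB T lab v ≡ true) ⊎ Two)
  blockX-ext = extend (restrict T (λ v → SetAB T lab v ≡ true)) f
    where
    f : Σ (Fin n) (λ v → SetAB T lab v ≡ true) → Two → Val
    f (v , _) new₁ = toVal (isA (lab v))
    f (v , _) new₂ = toVal (isB (lab v))

  -- T_Y for a homogeneous pair:
  -- T[Y] plus a (= new₁) strongly complete to C ∪ E, strongly anticomplete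
  -- to D ∪ F, and b (= new₂) strongly complete to D ∪ E, strongly
  -- anticomplete to C ∪ F; ab switchable.
  blockY-ext : Trigraph (Σ (Fin n) (λ v → SetAB T lab v ≡ false) ⊎ Two)
  blockY-ext = extend (restrict T (λ v → SetAB T lab v ≡ false)) f
    where
    f : Σ (Fin n) (λ v → SetAB T lab v ≡ false) → Two → Val
    f (v , _) new₁ = toVal ((SetC T lab ∪ SetE T lab) v)
    f (v , _) new₂ = toVal ((SetD T lab ∪ SetE T lab) v)

module Submission where

-- Blocks that are induced subtrigraphs (homogeneous-set blocks and the block
-- T[A ∪ B] of a small homogeneous pair) inherit odd-hole-freeness because an
-- embedding of trigraphs maps holes to holes.  The remaining blocks are an
-- induced subtrigraph plus two new vertices joined by a switchable pair.  A
-- hole avoiding one of the new vertices is copied into T by replacing each new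
-- vertex with an old vertex of the same profile: a ∈ A and b ∈ B for T_Y,
-- c ∈ C and d ∈ D for T_X (these exist since the pair is proper).  A hole
-- through both new vertices of T_Y is copied using a pair a ∈ A, b ∈ B that is
-- adjacent or antiadjacent exactly as the hole requires; such pairs exist as
-- A is neither strongly complete nor strongly anticomplete to B.  In T_X no odd
-- hole passes through both c and d: every vertex of A ∪ B is strongly adjacent
-- to exactly one of them, whereas by a parity count on the cycle some third
-- vertex of an odd hole is adjacent to both or antiadjacent to both.

open import Defs hiding (sym)
open import Data.Nat using (ℕ; suc; _+_; _≤_; _<_; _∸_; s≤s; s≤s⁻¹; z≤n; ∣_-_∣; parity)
open import Data.Nat.Properties
  using (_≟_; ≤-refl; ≤-trans; <-cmp; <⇒≢; n≤1+n; m≤m+n; m≤n+m; +-monoʳ-≤; +-comm; +-assoc; +-suc;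
         ∣-∣-comm; ∣n-n∣≡0; ∣m-m+n∣≡n; ∣m+n-m+o∣≡∣n-o∣; m≤n⇒∃[o]m+o≡n)
open import Data.Parity.Base using (0ℙ; 1ℙ)
import Data.Parity.Properties as Parity
open import Data.Fin using (Fin; toℕ; fromℕ<)
open import Data.Fin.Properties using (toℕ-injective; toℕ-fromℕ<; toℕ≤pred[n]; any?)
open import Data.Bool using (Bool; true; false; if_then_else_)
import Data.Bool.Properties as Bool
open import Data.Product using (Σ; _×_; _,_; proj₁; proj₂; ∃)
open import Data.Sum using (_⊎_; inj₁; inj₂)
open import Data.Empty using (⊥; ⊥-elim)
open import Relation.Nullary using (¬_; Dec; yes; no; ¬?)
open import Relation.Nullary.Decidable using (_⊎-dec_; _×-dec_; decidable-stable)
open import Relation.Binary.PropositionalEquality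
  using (_≡_; _≢_; refl; sym; trans; cong; subst; subst₂)
open import Relation.Binary.Definitions using (tri<; tri≈; tri>)
open import Function using (case_of_)
open import Axiom.UniquenessOfIdentityProofs.WithK using (uip)

-- Positions 0, …, K of a cycle of length K + 1: two positions are consecutive
-- when their distance is near, i.e. 1 or K.  'CycAdj (suc K) i j' unfolds to
-- 'Cyc K (toℕ i) (toℕ j)'.
Near : ℕ → ℕ → Set
Near K d = d ≡ 1 ⊎ d ≡ K

Cyc : ℕ → ℕ → ℕ → Set
Cyc K a b = Near K ∣ a - b ∣

Agree : {A : Set} → (A → Set) → A → A → Set
Agree P x y = (P x × P y) ⊎ (¬ P x × ¬ P y)

agree-swap : {A : Set} {P : A → Set} {x y : A} → Agree P x y → Agree P y x
agree-swap (inj₁ (px , py)) = inj₁ (py , px)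
agree-swap (inj₂ (px , py)) = inj₂ (py , px)

far : ∀ {K d} → d ≢ 1 → d ≢ K → ¬ Near K d
far d≢1 d≢K (inj₁ d≡1) = d≢1 d≡1
far d≢1 d≢K (inj₂ d≡K) = d≢K d≡K

-- On a cycle of odd length the last position K is even, so no odd distance equals it.
odd≢even : ∀ {d K} → parity d ≡ 1ℙ → parity K ≡ 0ℙ → d ≢ K
odd≢even pd pK refl = case trans (sym pd) pK of λ ()

∣m+n-m∣≡n : ∀ m n → ∣ m + n - m ∣ ≡ n
∣m+n-m∣≡n m n = trans (∣-∣-comm (m + n) m) (∣m-m+n∣≡n m n)

ThirdPosition : ℕ → ℕ → ℕ → Set
ThirdPosition K i j = ∃ λ m → m ≤ K × m ≢ i × m ≢ j × Agree (λ a → Cyc K a m) i j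

atDistances : ∀ {K i j d₁ d₂} m → m ≤ K → ∣ i - m ∣ ≡ suc d₁ → ∣ j - m ∣ ≡ suc d₂ →
              Agree (Near K) (suc d₁) (suc d₂) → ThirdPosition K i j
atDistances {K} m m≤K dist-i dist-j agree =
  m , m≤K , apart dist-i , apart dist-j , subst₂ (Agree (Near K)) (sym dist-i) (sym dist-j) agree
  where
  apart : ∀ {a d} → ∣ a - m ∣ ≡ suc d → m ≢ a
  apart dist refl = case trans (sym (∣n-n∣≡0 m)) dist of λ ()

-- An odd gap j - i with two free positions before i: the position i - 2 is near neither.
stepBack : ∀ {K} i gap r → parity gap ≡ 1ℙ → 2 + i + gap + r ≡ K → parity K ≡ 0ℙ → 3 ≤ K →
           ThirdPosition K (2 + i) (2 + i + gap)
stepBack i gap r odd refl pK 3≤K =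
  atDistances i bound dist-i dist-j (inj₂ (far (λ ()) (<⇒≢ 3≤K) , far (λ ()) (odd≢even odd pK)))
  where
  bound : i ≤ 2 + i + gap + r
  bound = ≤-trans (m≤n+m i 2) (≤-trans (m≤m+n (2 + i) gap) (m≤m+n (2 + i + gap) r))
  dist-i : ∣ 2 + i - i ∣ ≡ 2
  dist-i = trans (cong ∣_- i ∣ (+-comm 2 i)) (∣m+n-m∣≡n i 2)
  dist-j : ∣ 2 + i + gap - i ∣ ≡ 2 + gap
  dist-j = trans (cong ∣_- i ∣ (trans (cong (_+ gap) (+-comm 2 i)) (+-assoc i 2 gap))) (∣m+n-m∣≡n i (2 + gap))

-- An odd gap j - i with two free positions after j: the position j + 2 is near neither.
stepForward : ∀ {K} i gap r → parity gap ≡ 1ℙ → i + gap + (2 + r) ≡ K → parity K ≡ 0ℙ → 3 ≤ K →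
              ThirdPosition K i (i + gap)
stepForward i gap r odd refl pK 3≤K =
  atDistances (i + gap + 2) (+-monoʳ-≤ (i + gap) (m≤m+n 2 r)) dist-i (∣m-m+n∣≡n (i + gap) 2)
    (inj₂ (far (λ ()) (odd≢even odd pK) , far (λ ()) (<⇒≢ 3≤K)))
  where
  dist-i : ∣ i - i + gap + 2 ∣ ≡ 2 + gap
  dist-i = trans (cong ∣ i -_∣ (trans (+-assoc i gap 2) (cong (i +_) (+-comm gap 2)))) (∣m-m+n∣≡n i (2 + gap))

-- Gap 2: the midpoint.  Gap ≥ 4: the position i + 2.  Odd gap
-- 1 or 3: two steps outside, or, when there is no room (K = 4), the unique
-- position outside the gap.
thirdPositionℕ : ∀ {K} i gap r → i + suc gap + r ≡ K → parity K ≡ 0ℙ → 3 ≤ K →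
                 ThirdPosition K i (i + suc gap)
thirdPositionℕ i 1 r refl _ _ =
  atDistances (i + 1) (≤-trans (+-monoʳ-≤ i (n≤1+n 1)) (m≤m+n (i + 2) r))
    (∣m-m+n∣≡n i 1) (∣m+n-m+o∣≡∣n-o∣ i 2 1) (inj₁ (inj₁ refl , inj₁ refl))
thirdPositionℕ i (suc (suc (suc g))) r refl _ 3≤K =
  atDistances (i + 2) (≤-trans (+-monoʳ-≤ i (m≤m+n 2 (2 + g))) (m≤m+n (i + (4 + g)) r))
    (∣m-m+n∣≡n i 2) (∣m+n-m+o∣≡∣n-o∣ i (4 + g) 2)
    (inj₂ (far (λ ()) (<⇒≢ 3≤K) , far (λ ()) (<⇒≢ 2+g<K)))
  where
  2+g<K : 2 + g < i + (4 + g) + r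
  2+g<K = ≤-trans (n≤1+n (3 + g)) (≤-trans (m≤n+m (4 + g) i) (m≤m+n (i + (4 + g)) r))
thirdPositionℕ (suc (suc i)) 0 r e pK 3≤K = stepBack i 1 r refl e pK 3≤K
thirdPositionℕ (suc (suc i)) 2 r e pK 3≤K = stepBack i 3 r refl e pK 3≤K
thirdPositionℕ i 0 (suc (suc r)) e pK 3≤K = stepForward i 1 r refl e pK 3≤K
thirdPositionℕ i 2 (suc (suc r)) e pK 3≤K = stepForward i 3 r refl e pK 3≤K
thirdPositionℕ 0 2 1 refl _ _ = atDistances 4 ≤-refl refl refl (inj₁ (inj₂ refl , inj₁ refl))
thirdPositionℕ 1 2 0 refl _ _ = atDistances 0 z≤n refl refl (inj₁ (inj₁ refl , inj₂ refl))
thirdPositionℕ 0 0 0 refl () _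
thirdPositionℕ 0 0 1 refl _ (s≤s (s≤s ()))
thirdPositionℕ 1 0 0 refl _ (s≤s (s≤s ()))
thirdPositionℕ 1 0 1 refl () _
thirdPositionℕ 0 2 0 refl () _
thirdPositionℕ 1 2 1 refl () _

ThirdIndex : (k : ℕ) → Fin k → Fin k → Set
ThirdIndex k i j = ∃ λ m → m ≢ i × m ≢ j × Agree (λ a → CycAdj k a m) i j

fromℕ-position : ∀ {K} (i j : Fin (suc K)) → ThirdPosition K (toℕ i) (toℕ j) → ThirdIndex (suc K) i j
fromℕ-position {K} i j (m , m≤K , m≢i , m≢j , agree) =
  fromℕ< (s≤s m≤K) , (λ e → m≢i (trans (sym back) (cong toℕ e))) , (λ e → m≢j (trans (sym back) (cong toℕ e))) ,
  subst (λ x → Agree (λ a → Cyc K (toℕ a) x) i j) (sym back) agree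
  where
  back : toℕ (fromℕ< (s≤s m≤K)) ≡ m
  back = toℕ-fromℕ< (s≤s m≤K)

thirdIndexOrdered : ∀ {K} → parity K ≡ 0ℙ → 3 ≤ K → (i j : Fin (suc K)) → toℕ i < toℕ j → ThirdIndex (suc K) i j
thirdIndexOrdered {K} pK 3≤K i j i<j with m≤n⇒∃[o]m+o≡n i<j | m≤n⇒∃[o]m+o≡n (toℕ≤pred[n] j)
... | gap , i+1+gap≡j | r , j+r≡K =
  fromℕ-position i j (subst (ThirdPosition K (toℕ i)) i+gap≡j
    (thirdPositionℕ (toℕ i) gap r (trans (cong (_+ r) i+gap≡j) j+r≡K) pK 3≤K))
  where
  i+gap≡j : toℕ i + suc gap ≡ toℕ j
  i+gap≡j = trans (+-suc (toℕ i) gap) i+1+gap≡j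

thirdIndex : ∀ {k} → OddN k → 4 ≤ k → (i j : Fin k) → i ≢ j → ThirdIndex k i j
thirdIndex {suc K} (q , refl) 4≤k i j i≢j with <-cmp (toℕ i) (toℕ j)
... | tri< i<j _ _ = thirdIndexOrdered (Parity.*-homo-* 2 q) (s≤s⁻¹ 4≤k) i j i<j
... | tri≈ _ i≡j _ = ⊥-elim (i≢j (toℕ-injective i≡j))
... | tri> _ _ j<i with thirdIndexOrdered (Parity.*-homo-* 2 q) (s≤s⁻¹ 4≤k) j i j<i
...   | m , m≢j , m≢i , agree = m , m≢i , m≢j , agree-swap {P = λ a → CycAdj (suc K) a m} {j} {i} agree

cycAdj? : ∀ k (i j : Fin k) → Dec (CycAdj k i j)
cycAdj? k i j = (∣ toℕ i - toℕ j ∣ ≟ 1) ⊎-dec (∣ toℕ i - toℕ j ∣ ≟ k ∸ 1)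

cycAdj-sym : ∀ {k} (i j : Fin k) → CycAdj k i j → CycAdj k j i
cycAdj-sym {k} i j = subst (λ d → d ≡ 1 ⊎ d ≡ k ∸ 1) (∣-∣-comm (toℕ i) (toℕ j))

HoleEdge : (k : ℕ) → Fin k → Fin k → Val → Set
HoleEdge k i j t = (CycAdj k i j → Adjacent t) × (¬ CycAdj k i j → Antiadjacent t)

holeEdge-sym : ∀ {k} i j {t} → HoleEdge k i j t → HoleEdge k j i t
holeEdge-sym i j (adj , antiadj) = (λ c → adj (cycAdj-sym j i c)) , (λ nc → antiadj (λ c → nc (cycAdj-sym i j c)))

edgeOfAdjacent : ∀ {k i j t} → CycAdj k i j → Adjacent t → HoleEdge k i j t
edgeOfAdjacent c adj = (λ _ → adj) , (λ nc → ⊥-elim (nc c))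

edgeOfAntiadjacent : ∀ {k i j t} → ¬ CycAdj k i j → Antiadjacent t → HoleEdge k i j t
edgeOfAntiadjacent nc antiadj = (λ c → ⊥-elim (nc c)) , (λ _ → antiadj)

holeEdge : ∀ {V} {T : Trigraph V} {k} (H : Hole T k) {i j} → i ≢ j → HoleEdge k i j (θ T (Hole.h H i) (Hole.h H j))
holeEdge H {i} {j} i≢j = Hole.adj H i j i≢j , Hole.antiadj H i j i≢j

mapHole : ∀ {V W} {T : Trigraph V} {T' : Trigraph W} {k} (H : Hole T k) (g : V → W) →
          (∀ u v → g u ≡ g v → u ≡ v) →
          (∀ i j → i ≢ j → HoleEdge k i j (θ T' (g (Hole.h H i)) (g (Hole.h H j)))) → Hole T' k
mapHole H g g-injective edge = record
  { h        = λ i → g (h i)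
  ; length≥4 = length≥4
  ; distinct = λ i j e → distinct i j (g-injective _ _ e)
  ; adj      = λ i j i≢j → proj₁ (edge i j i≢j)
  ; antiadj  = λ i j i≢j → proj₂ (edge i j i≢j) }
  where open Hole H

embeddingOddHoleFree : ∀ {V W} {T : Trigraph V} {T' : Trigraph W} (g : V → W) →
                       (∀ u v → g u ≡ g v → u ≡ v) → (∀ u v → θ T' (g u) (g v) ≡ θ T u v) →
                       OddHoleFree T' → OddHoleFree T
embeddingOddHoleFree g g-injective g-θ free k odd H =
  free k odd (mapHole H g g-injective λ i j i≢j → subst (HoleEdge k i j) (sym (g-θ _ _)) (holeEdge H i≢j))

inducedOddHoleFree : ∀ {V} (T : Trigraph V) (P : V → Set) → (∀ {v} (p q : P v) → p ≡ q) →
                     OddHoleFree T → OddHoleFree (restrict T P)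
inducedOddHoleFree T P P-irrelevant = embeddingOddHoleFree proj₁ proj₁-injective (λ _ _ → refl)
  where
  proj₁-injective : (u v : Σ _ P) → proj₁ u ≡ proj₁ v → u ≡ v
  proj₁-injective (u , p) (.u , q) refl = cong (u ,_) (P-irrelevant p q)

Complementary : Val → Val → Set
Complementary s t = (s ≡ pos × t ≡ neg) ⊎ (s ≡ neg × t ≡ pos)

¬adjacent-neg : ¬ Adjacent neg
¬adjacent-neg (inj₁ ())
¬adjacent-neg (inj₂ ())

¬antiadjacent-pos : ¬ Antiadjacent pos
¬antiadjacent-pos (inj₁ ())
¬antiadjacent-pos (inj₂ ())

complementary-clash : ∀ {s t} → Complementary s t → ¬ ((Adjacent s × Adjacent t) ⊎ (Antiadjacent s × Antiadjacent t))
complementary-clash (inj₁ (refl , refl)) (inj₁ (_ , adj)) = ¬adjacent-neg adj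
complementary-clash (inj₁ (refl , refl)) (inj₂ (antiadj , _)) = ¬antiadjacent-pos antiadj
complementary-clash (inj₂ (refl , refl)) (inj₁ (adj , _)) = ¬adjacent-neg adj
complementary-clash (inj₂ (refl , refl)) (inj₂ (_ , antiadj)) = ¬antiadjacent-pos antiadj

-- No two vertices of an odd hole are complementary towards all other hole
-- vertices, since some third vertex is adjacent to both or antiadjacent to both.
noComplementaryPair : ∀ {V} {T : Trigraph V} {k} → OddN k → (H : Hole T k) → ∀ {i j} → i ≢ j →
  ¬ (∀ m → m ≢ i → m ≢ j → Complementary (θ T (Hole.h H i) (Hole.h H m)) (θ T (Hole.h H j) (Hole.h H m)))
noComplementaryPair {T = T} {k} odd H {i} {j} i≢j complementary
  with thirdIndex odd (Hole.length≥4 H) i j i≢j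
... | m , m≢i , m≢j , agree = complementary-clash (complementary m m≢i m≢j) (sameSide agree)
  where
  open Hole H
  edge-i : HoleEdge k i m (θ T (h i) (h m))
  edge-i = holeEdge H (λ e → m≢i (sym e))
  edge-j : HoleEdge k j m (θ T (h j) (h m))
  edge-j = holeEdge H (λ e → m≢j (sym e))
  sameSide : Agree (λ a → CycAdj k a m) i j →
             (Adjacent (θ T (h i) (h m)) × Adjacent (θ T (h j) (h m))) ⊎
             (Antiadjacent (θ T (h i) (h m)) × Antiadjacent (θ T (h j) (h m)))
  sameSide (inj₁ (ci , cj)) = inj₁ (proj₁ edge-i ci , proj₁ edge-j cj)
  sameSide (inj₂ (ni , nj)) = inj₂ (proj₂ edge-i ni , proj₂ edge-j nj)

isNew? : ∀ {W : Set} (t : Two) (x : W ⊎ Two) → Dec (x ≡ inj₂ t)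
isNew? t    (inj₁ _)    = no λ ()
isNew? new₁ (inj₂ new₁) = yes refl
isNew? new₁ (inj₂ new₂) = no λ ()
isNew? new₂ (inj₂ new₁) = no λ ()
isNew? new₂ (inj₂ new₂) = yes refl

-- Trigraphs T' obtained from the induced subtrigraph T[P] by adding two new
-- vertices (the blocks T_X and T_Y of a homogeneous pair).
module TwoNewVertices {V : Set} (T : Trigraph V) (P : V → Set) (P-irrelevant : ∀ {v} (p q : P v) → p ≡ q)
                      (T' : Trigraph (Σ V P ⊎ Two))
                      (old : ∀ u v → θ T' (inj₁ u) (inj₁ v) ≡ θ T (proj₁ u) (proj₁ v)) where

  record Representatives : Set where
    field
      rep          : Two → V
      outside      : ∀ t → ¬ P (rep t)
      rep-distinct : rep new₁ ≢ rep new₂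
      profile      : ∀ u t → θ T (proj₁ u) (rep t) ≡ θ T' (inj₁ u) (inj₂ t)

  locateNew : ∀ {k} (H : Hole T' k) →
              (∃ λ i → ∃ λ j → Hole.h H i ≡ inj₂ new₁ × Hole.h H j ≡ inj₂ new₂)
              ⊎ ((∀ i → Hole.h H i ≢ inj₂ new₁) ⊎ (∀ j → Hole.h H j ≢ inj₂ new₂))
  locateNew H with any? (λ i → isNew? new₁ (Hole.h H i)) | any? (λ j → isNew? new₂ (Hole.h H j))
  ... | yes (i , ei) | yes (j , ej) = inj₁ (i , j , ei , ej)
  ... | no none₁     | _            = inj₂ (inj₁ λ i ei → none₁ (i , ei))
  ... | yes _        | no none₂     = inj₂ (inj₂ λ j ej → none₂ (j , ej))

  module _ (R : Representatives) where
    open Representatives R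

    realise : Σ V P ⊎ Two → V
    realise (inj₁ u) = proj₁ u
    realise (inj₂ t) = rep t

    realise-injective : ∀ x y → realise x ≡ realise y → x ≡ y
    realise-injective (inj₁ (u , p)) (inj₁ (.u , q)) refl = cong (λ p → inj₁ (u , p)) (P-irrelevant p q)
    realise-injective (inj₁ (u , p)) (inj₂ t) refl = ⊥-elim (outside t p)
    realise-injective (inj₂ t) (inj₁ (u , p)) refl = ⊥-elim (outside t p)
    realise-injective (inj₂ new₁) (inj₂ new₁) _ = refl
    realise-injective (inj₂ new₂) (inj₂ new₂) _ = refl
    realise-injective (inj₂ new₁) (inj₂ new₂) e = ⊥-elim (rep-distinct e)
    realise-injective (inj₂ new₂) (inj₂ new₁) e = ⊥-elim (rep-distinct (sym e))

    realise-old : ∀ x u → θ T (realise x) (proj₁ u) ≡ θ T' x (inj₁ u)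
    realise-old (inj₁ v) u = sym (old v u)
    realise-old (inj₂ t) u =
      trans (Trigraph.sym T (rep t) (proj₁ u)) (trans (profile u t) (Trigraph.sym T' (inj₁ u) (inj₂ t)))

    realiseHole : ∀ {k} (H : Hole T' k) →
                  (∀ i j → Hole.h H i ≡ inj₂ new₁ → Hole.h H j ≡ inj₂ new₂ → HoleEdge k i j (θ T (rep new₁) (rep new₂))) →
                  Hole T k
    realiseHole {k} H newEdge = mapHole H realise realise-injective (λ i j i≢j → edgeAt i j i≢j (h i) (h j) refl refl)
      where
      open Hole H
      kept : ∀ {i j x y} → i ≢ j → h i ≡ x → h j ≡ y → θ T (realise x) (realise y) ≡ θ T' x y →
             HoleEdge k i j (θ T (realise x) (realise y))
      kept {i} {j} i≢j refl refl preserved = subst (HoleEdge k i j) (sym preserved) (holeEdge H i≢j)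
      edgeAt : ∀ i j → i ≢ j → ∀ x y → h i ≡ x → h j ≡ y → HoleEdge k i j (θ T (realise x) (realise y))
      edgeAt i j i≢j x (inj₁ u) ei ej = kept i≢j ei ej (realise-old x u)
      edgeAt i j i≢j (inj₁ u) (inj₂ t) ei ej = kept i≢j ei ej (profile u t)
      edgeAt i j i≢j (inj₂ new₁) (inj₂ new₂) ei ej = newEdge i j ei ej
      edgeAt i j i≢j (inj₂ new₂) (inj₂ new₁) ei ej =
        holeEdge-sym j i (subst (HoleEdge k j i) (Trigraph.sym T (rep new₁) (rep new₂)) (newEdge j i ej ei))
      edgeAt i j i≢j (inj₂ new₁) (inj₂ new₁) ei ej = ⊥-elim (i≢j (distinct i j (trans ei (sym ej))))
      edgeAt i j i≢j (inj₂ new₂) (inj₂ new₂) ei ej = ⊥-elim (i≢j (distinct i j (trans ei (sym ej))))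

    realiseAvoiding : ∀ {k} (H : Hole T' k) →
                      (∀ i → Hole.h H i ≢ inj₂ new₁) ⊎ (∀ j → Hole.h H j ≢ inj₂ new₂) → Hole T k
    realiseAvoiding H (inj₁ no₁) = realiseHole H λ i _ ei _ → ⊥-elim (no₁ i ei)
    realiseAvoiding H (inj₂ no₂) = realiseHole H λ _ j _ ej → ⊥-elim (no₂ j ej)

    realiseThrough : ∀ {k} (H : Hole T' k) {i j} → Hole.h H i ≡ inj₂ new₁ → Hole.h H j ≡ inj₂ new₂ →
                     HoleEdge k i j (θ T (rep new₁) (rep new₂)) → Hole T k
    realiseThrough {k} H {i} {j} ei ej edge = realiseHole H λ i' j' ei' ej' →
      subst₂ (λ a b → HoleEdge k a b (θ T (rep new₁) (rep new₂)))
             (Hole.distinct H i i' (trans ei (sym ei'))) (Hole.distinct H j j' (trans ej (sym ej'))) edge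

  extensionOddHoleFree : Representatives →
    (∀ {k} → OddN k → (H : Hole T' k) → ∀ {i j} → Hole.h H i ≡ inj₂ new₁ → Hole.h H j ≡ inj₂ new₂ → Hole T k) →
    OddHoleFree T → OddHoleFree T'
  extensionOddHoleFree R through free k odd H with locateNew H
  ... | inj₁ (i , j , ei , ej) = free k odd (through odd H ei ej)
  ... | inj₂ missing           = free k odd (realiseAvoiding R H missing)

_≟ᵥ_ : (s t : Val) → Dec (s ≡ t)
neg ≟ᵥ neg = yes refl
neg ≟ᵥ zer = no λ ()
neg ≟ᵥ pos = no λ ()
zer ≟ᵥ neg = no λ ()
zer ≟ᵥ zer = yes refl
zer ≟ᵥ pos = no λ ()
pos ≟ᵥ neg = no λ ()
pos ≟ᵥ zer = no λ ()
pos ≟ᵥ pos = yes refl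

adjacent-if-≢neg : ∀ t → t ≢ neg → Adjacent t
adjacent-if-≢neg neg t≢neg = ⊥-elim (t≢neg refl)
adjacent-if-≢neg zer _     = inj₁ refl
adjacent-if-≢neg pos _     = inj₂ refl

antiadjacent-if-≢pos : ∀ t → t ≢ pos → Antiadjacent t
antiadjacent-if-≢pos neg _     = inj₁ refl
antiadjacent-if-≢pos zer _     = inj₂ refl
antiadjacent-if-≢pos pos t≢pos = ⊥-elim (t≢pos refl)

counterexample : ∀ {n} (T : Trigraph (Fin n)) (X Y : Fin n → Bool) (t : Val) →
                 ¬ (∀ x y → X x ≡ true → Y y ≡ true → θ T x y ≡ t) →
                 ∃ λ x → ∃ λ y → X x ≡ true × Y y ≡ true × θ T x y ≢ t
counterexample T X Y t not-constant
  with any? (λ x → any? (λ y → (X x Bool.≟ true) ×-dec (Y y Bool.≟ true) ×-dec ¬? (θ T x y ≟ᵥ t)))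
... | yes (x , y , found) = x , y , found
... | no none = ⊥-elim (not-constant λ x y x∈X y∈Y →
                  decidable-stable (θ T x y ≟ᵥ t) λ θ≢t → none (x , y , x∈X , y∈Y , θ≢t))

fromIsA : ∀ p → isA p ≡ true → p ≡ pA
fromIsA pA _ = refl
fromIsA pB ()
fromIsA pC ()
fromIsA pD ()
fromIsA pE ()
fromIsA pF ()

fromIsB : ∀ p → isB p ≡ true → p ≡ pB
fromIsB pA ()
fromIsB pB _ = refl
fromIsB pC ()
fromIsB pD ()
fromIsB pE ()
fromIsB pF ()

partsDiffer : ∀ {n} (lab : Fin n → Part) {u v p q} → lab u ≡ p → lab v ≡ q → p ≢ q → u ≢ v
partsDiffer lab lu lv p≢q refl = p≢q (trans (sym lu) lv)

module BlockY {n : ℕ} (T : Trigraph (Fin n)) (lab : Fin n → Part) (HP : HomogeneousPair T lab) where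
  open HomogeneousPair HP
  open TwoNewVertices T (λ v → SetAB T lab v ≡ false) uip (blockY-ext T lab) (λ _ _ → refl)

  profileA : ∀ {a} → lab a ≡ pA → ∀ v → isAB (lab v) ≡ false → θ T v a ≡ toVal ((SetC T lab ∪ SetE T lab) v)
  profileA {a} la v _ with lab v in lv
  ... | pC = trans (Trigraph.sym T v a) (A-CE a v (cong isA la) (cong (λ p → if isC p then true else isE p) lv))
  ... | pE = trans (Trigraph.sym T v a) (A-CE a v (cong isA la) (cong (λ p → if isC p then true else isE p) lv))
  ... | pD = trans (Trigraph.sym T v a) (A-DF a v (cong isA la) (cong (λ p → if isD p then true else isF p) lv))
  ... | pF = trans (Trigraph.sym T v a) (A-DF a v (cong isA la) (cong (λ p → if isD p then true else isF p) lv))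

  profileB : ∀ {b} → lab b ≡ pB → ∀ v → isAB (lab v) ≡ false → θ T v b ≡ toVal ((SetD T lab ∪ SetE T lab) v)
  profileB {b} lb v _ with lab v in lv
  ... | pD = trans (Trigraph.sym T v b) (B-DE b v (cong isB lb) (cong (λ p → if isD p then true else isE p) lv))
  ... | pE = trans (Trigraph.sym T v b) (B-DE b v (cong isB lb) (cong (λ p → if isD p then true else isE p) lv))
  ... | pC = trans (Trigraph.sym T v b) (B-CF b v (cong isB lb) (cong (λ p → if isC p then true else isF p) lv))
  ... | pF = trans (Trigraph.sym T v b) (B-CF b v (cong isB lb) (cong (λ p → if isC p then true else isF p) lv))

  representatives : ∀ {a b} → lab a ≡ pA → lab b ≡ pB → Representatives
  representatives {a} {b} la lb = record
    { rep          = λ { new₁ → a ; new₂ → b }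
    ; outside      = λ { new₁ out → case trans (sym out) (cong isAB la) of λ ()
                       ; new₂ out → case trans (sym out) (cong isAB lb) of λ () }
    ; rep-distinct = partsDiffer lab la lb λ ()
    ; profile      = λ { (v , out) new₁ → profileA la v out ; (v , out) new₂ → profileB lb v out } }

  adjacentPair : ∃ λ a → ∃ λ b → lab a ≡ pA × lab b ≡ pB × Adjacent (θ T a b)
  adjacentPair with counterexample T (SetA T lab) (SetB T lab) neg A-B-not-SAC
  ... | a , b , a∈A , b∈B , θ≢neg = a , b , fromIsA _ a∈A , fromIsB _ b∈B , adjacent-if-≢neg _ θ≢neg

  antiadjacentPair : ∃ λ a → ∃ λ b → lab a ≡ pA × lab b ≡ pB × Antiadjacent (θ T a b)
  antiadjacentPair with counterexample T (SetA T lab) (SetB T lab) pos A-B-not-SC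
  ... | a , b , a∈A , b∈B , θ≢pos = a , b , fromIsA _ a∈A , fromIsB _ b∈B , antiadjacent-if-≢pos _ θ≢pos

  through : ∀ {k} (H : Hole (blockY-ext T lab) k) {i j} →
            Hole.h H i ≡ inj₂ new₁ → Hole.h H j ≡ inj₂ new₂ → Hole T k
  through {k} H {i} {j} ei ej with cycAdj? k i j | adjacentPair | antiadjacentPair
  ... | yes c  | _ , _ , la , lb , adj | _ =
    realiseThrough (representatives la lb) H ei ej (edgeOfAdjacent {k} {i} {j} c adj)
  ... | no nc  | _ | _ , _ , la , lb , antiadj =
    realiseThrough (representatives la lb) H ei ej (edgeOfAntiadjacent {k} {i} {j} nc antiadj)

  oddHoleFree : OddHoleFree T → OddHoleFree (blockY-ext T lab)
  oddHoleFree = extensionOddHoleFree (representatives (proj₂ A-nonempty) (proj₂ B-nonempty)) (λ _ → through)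

module BlockX {n : ℕ} (T : Trigraph (Fin n)) (lab : Fin n → Part) (HP : HomogeneousPair T lab) where
  open HomogeneousPair HP
  open TwoNewVertices T (λ v → SetAB T lab v ≡ true) uip (blockX-ext T lab) (λ _ _ → refl)

  profileC : ∀ {c} → lab c ≡ pC → ∀ v → isAB (lab v) ≡ true → θ T v c ≡ toVal (isA (lab v))
  profileC {c} lc v _ with lab v in lv
  ... | pA = A-CE v c (cong isA lv) (cong (λ p → if isC p then true else isE p) lc)
  ... | pB = B-CF v c (cong isB lv) (cong (λ p → if isC p then true else isF p) lc)

  profileD : ∀ {d} → lab d ≡ pD → ∀ v → isAB (lab v) ≡ true → θ T v d ≡ toVal (isB (lab v))
  profileD {d} ld v _ with lab v in lv
  ... | pA = A-DF v d (cong isA lv) (cong (λ p → if isD p then true else isF p) ld)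
  ... | pB = B-DE v d (cong isB lv) (cong (λ p → if isD p then true else isE p) ld)

  representatives : ∀ {c d} → lab c ≡ pC → lab d ≡ pD → Representatives
  representatives {c} {d} lc ld = record
    { rep          = λ { new₁ → c ; new₂ → d }
    ; outside      = λ { new₁ inside → case trans (sym inside) (cong isAB lc) of λ ()
                       ; new₂ inside → case trans (sym inside) (cong isAB ld) of λ () }
    ; rep-distinct = partsDiffer lab lc ld λ ()
    ; profile      = λ { (v , inside) new₁ → profileC lc v inside ; (v , inside) new₂ → profileD ld v inside } }

  splitByNew : ∀ u → Complementary (θ (blockX-ext T lab) (inj₂ new₁) (inj₁ u)) (θ (blockX-ext T lab) (inj₂ new₂) (inj₁ u))
  splitByNew (v , _) with lab v
  ... | pA = inj₁ (refl , refl)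
  ... | pB = inj₂ (refl , refl)

  noOddHoleThrough : ∀ {k} → OddN k → (H : Hole (blockX-ext T lab) k) → ∀ {i j} →
                     Hole.h H i ≡ inj₂ new₁ → Hole.h H j ≡ inj₂ new₂ → ⊥
  noOddHoleThrough odd H {i} {j} ei ej =
    noComplementaryPair odd H (λ i≡j → case trans (sym ei) (trans (cong h i≡j) ej) of λ ()) complementary
    where
    open Hole H
    complementary : ∀ m → m ≢ i → m ≢ j →
                    Complementary (θ (blockX-ext T lab) (h i) (h m)) (θ (blockX-ext T lab) (h j) (h m))
    complementary m m≢i m≢j with h m in em
    ... | inj₁ u    = subst₂ (λ x y → Complementary (θ (blockX-ext T lab) x (inj₁ u)) (θ (blockX-ext T lab) y (inj₁ u)))
                             (sym ei) (sym ej) (splitByNew u)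
    ... | inj₂ new₁ = ⊥-elim (m≢i (distinct m i (trans em (sym ei))))
    ... | inj₂ new₂ = ⊥-elim (m≢j (distinct m j (trans em (sym ej))))

  oddHoleFree : Proper T lab → OddHoleFree T → OddHoleFree (blockX-ext T lab)
  oddHoleFree ((_ , lc) , (_ , ld)) =
    extensionOddHoleFree (representatives lc ld) (λ odd H ei ej → ⊥-elim (noOddHoleThrough odd H ei ej))

-- For a homogeneous set X with x ∈ X, the block T[Y ∪ {x}] (Y the complement
-- of X) is cut out by a proof-irrelevant predicate, since x ∉ Y.
insideYorX-irrelevant : ∀ {n} (X : Fin n → Bool) x → X x ≡ true →
                        ∀ {v} (p q : X v ≡ false ⊎ v ≡ x) → p ≡ q
insideYorX-irrelevant X x x∈X (inj₁ p) (inj₁ q) = cong inj₁ (uip p q)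
insideYorX-irrelevant X x x∈X (inj₂ p) (inj₂ q) = cong inj₂ (uip p q)
insideYorX-irrelevant X x x∈X (inj₁ p) (inj₂ refl) = case trans (sym p) x∈X of λ ()
insideYorX-irrelevant X x x∈X (inj₂ refl) (inj₁ q) = case trans (sym q) x∈X of λ ()

lemma5p6 : {n : ℕ} (T : Trigraph (Fin n)) → OddHoleFree T →
    ((X : Fin n → Bool) → HomogeneousSet T X →
      OddHoleFree (restrict T (λ v → X v ≡ true))
      × ((x : Fin n) → X x ≡ true →
          OddHoleFree (restrict T (λ v → X v ≡ false ⊎ v ≡ x))))
    × ((lab : Fin n → Part) → HomogeneousPair T lab →
      (Small T lab ⊎ Proper T lab) →
      (Small T lab → OddHoleFree (restrict T (λ v → SetAB T lab v ≡ true)))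
      × (¬ Small T lab → OddHoleFree (blockX-ext T lab))
      × OddHoleFree (blockY-ext T lab))
lemma5p6 T free =
  (λ X _ → inducedOddHoleFree T _ uip free ,
           λ x x∈X → inducedOddHoleFree T _ (insideYorX-irrelevant X x x∈X) free) ,
  (λ lab HP smallOrProper →
     (λ _ → inducedOddHoleFree T _ uip free) ,
     (λ notSmall → BlockX.oddHoleFree T lab HP (properIfNotSmall smallOrProper notSmall) free) ,
     BlockY.oddHoleFree T lab HP free)
  where
  properIfNotSmall : ∀ {S P : Set} → S ⊎ P → ¬ S → P
  properIfNotSmall (inj₁ small) notSmall = ⊥-elim (notSmall small)
  properIfNotSmall (inj₂ proper) _       = proper
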